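{- For all $n\ge 1$, $\left|\mathrm{Av}_n[\overline{14}32]\right|=C_{n-1}$, where $C_m=\frac{1}{m+1}\binom{2m}{m}$ is the $m$th Catalan number.
   Context: For $\sigma\in S_n$, the cyclic permutation $[\sigma]$ is the set of all rotations of $\sigma$; $[S_n]$ is the set of cyclic permutations of length $n$. $[\sigma]$ contains the vincular cyclic pattern $[\overline{14}32]$ if some rotation of $\sigma$ has a subsequence $xyzw$ order-isomorphic to $1432$ with $x,y$ in adjacent positions of that rotation; otherwise it avoids it. $\mathrm{Av}_n[\overline{14}32]$ is the set of $[\sigma]\in[S_n]$ avoiding $[\overline{14}32]$. -}

module Defs where

open import Data.Nat using (ℕ; zero; suc; _+_; _*_; _<_)
open import Data.Nat.DivMod using (_%_; _/_; m%n<n)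
open import Data.Nat.Combinatorics using (_C_)
open import Data.Fin using (Fin; toℕ; fromℕ<)
open import Data.Product using (Σ; ∃; _×_; _,_; proj₁)
open import Data.List using (List; length)
open import Data.List.Relation.Unary.All using (All)
open import Data.List.Relation.Unary.Any using (Any)
open import Data.List.Relation.Unary.AllPairs using (AllPairs)
open import Function.Definitions using (Injective)
open import Relation.Binary.PropositionalEquality using (_≡_)
open import Relation.Nullary using (¬_)

-- A permutation of length n = suc m (n ≥ 1), in one-line notation:
-- position i ↦ value σ i, σ injective (hence bijective) on Fin n.
Perm : ℕ → Set
Perm m = Σ (Fin (suc m) → Fin (suc m)) (Injective _≡_ _≡_)

rotate : ∀ {m} → ℕ → (Fin (suc m) → Fin (suc m)) → (Fin (suc m) → Fin (suc m))
rotate {m} k σ i = σ (fromℕ< (m%n<n (toℕ i + k) (suc m)))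

SameCyclic : ∀ {m} → Perm m → Perm m → Set
SameCyclic {m} τ σ = ∃ λ k → k < suc m × (∀ i → proj₁ τ i ≡ rotate k (proj₁ σ) i)

ContainsV1432 : ∀ {m} → (Fin (suc m) → Fin (suc m)) → Set
ContainsV1432 {m} w =
  Σ (Fin (suc m)) λ a → Σ (Fin (suc m)) λ b → Σ (Fin (suc m)) λ c → Σ (Fin (suc m)) λ d →
    (toℕ b ≡ suc (toℕ a)) × (toℕ b < toℕ c) × (toℕ c < toℕ d) ×
    (toℕ (w a) < toℕ (w d)) × (toℕ (w d) < toℕ (w c)) × (toℕ (w c) < toℕ (w b))

-- The cyclic permutation [σ] contains [\overline{14}32] iff some rotation of σ does.
CycContains : ∀ {m} → Perm m → Set
CycContains {m} σ = ∃ λ k → k < suc m × ContainsV1432 (rotate k (proj₁ σ))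

CycAvoids : ∀ {m} → Perm m → Set
CycAvoids σ = ¬ CycContains σ

-- |Av_n[\overline{14}32]| = N  (n = suc m), stated as: there is a list of
-- representatives, one per cyclic class: every listed permutation avoids,
-- no two listed ones are rotations of each other, every avoiding permutation
-- is a rotation of a listed one, and the list has length N.
-- (A complete system of distinct representatives of the classes in Av_n.)
AvCount : ℕ → ℕ → Set
AvCount m N = Σ (List (Perm m)) λ L →
  All CycAvoids L ×
  AllPairs (λ τ σ → ¬ SameCyclic τ σ) L ×
  (∀ (σ : Perm m) → CycAvoids σ → Any (SameCyclic σ) L) ×
  length L ≡ N

catalan : ℕ → ℕ
catalan m = ((2 * m) C m) / suc m

-- Every cyclic permutation of 0 … n has exactly one rotation starting with its maximum n, so the
-- classes in Av_{n+1}[\overline{14}32] correspond to the avoiding words n ∷ v.  Deleting the maximum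
-- of such a word and rotating to the new maximum yields an avoiding word of length n; conversely the
-- avoiding words of length n + 1 arise from those of length n by inserting n + 1 at an active site,
-- a gap after some letter y such that no inversion lies strictly between y and n + 1 in the rest of
-- the cyclic word.  A word with ℓ active sites has children with ℓ + 1, ℓ, …, 2 active sites, so the
-- words form the Catalan generating tree (ℓ) ↝ (2)(3)⋯(ℓ + 1) rooted at (1), whose level m has
-- C(2m, m) − C(2m, m + 1) = C_m nodes.

module Submission where

open import Data.Nat
open import Data.Nat.Properties
open import Data.Nat.Combinatorics using (_C_; nC1≡n; k>n⇒nCk≡0) renaming (nCk+nC[k+1]≡[n+1]C[k+1] to pascal)
open import Data.Nat.DivMod using (_/_; _%_; m*n/n≡m; m%n<n; m<n⇒m%n≡m; [m+n]%n≡m%n)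
open import Data.Fin using (Fin; toℕ; fromℕ<; punchOut)
import Data.Fin.Properties as Fin
open import Data.Nat.ListAction using (sum)
open import Data.Nat.ListAction.Properties using (sum-++)
open import Data.List
  using (List; []; _∷_; _++_; _∷ʳ_; [_]; length; map; filter; concatMap; applyDownFrom; tabulate; take; drop;
         initLast; _∷ʳ′_)
open import Data.List.Properties
  using (++-assoc; ++-identityʳ; ++-cancelˡ; ∷-injective; ∷ʳ-injective; length-++; length-tabulate; length-drop;
         tabulate-cong; take++drop≡id; map-∘; map-++; map-cong-local; map-applyDownFrom; filter-++; filter-accept;
         filter-reject; filter-none)
open import Data.List.Membership.Propositional using (_∈_; _∉_; find; lose; mapWith∈)
import Data.List.Membership.Setoid.Properties as Membershipₛ
import Data.List.Relation.Unary.Any.Properties as Anyₚ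
open import Data.List.Membership.Propositional.Properties
  using (∈-++⁺ˡ; ∈-++⁺ʳ; ∈-++⁻; ∈-tabulate⁺; ∈-map⁺; ∈-map⁻; ∈-filter⁺; ∈-filter⁻; ∈-∃++;
         ∈-concatMap⁺; ∈-concatMap⁻)
open import Data.List.Relation.Unary.Any using (Any; here; there; any?)
open import Data.List.Relation.Unary.All as All using (All; []; _∷_)
import Data.List.Relation.Unary.All.Properties as Allₚ
open import Data.List.Relation.Unary.Unique.Propositional using (Unique)
open import Data.List.Relation.Unary.AllPairs using (AllPairs; []; _∷_)
import Data.List.Relation.Unary.AllPairs.Properties as AllPairsₚ
import Data.List.Relation.Unary.Unique.Propositional.Properties as Uniqueₚ
open import Data.List.Relation.Binary.Permutation.Propositional using (_↭_; ↭-sym; ↭⇒↭ₛ′)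
open import Data.List.Relation.Binary.Permutation.Propositional.Properties using (++-comm; ∈-resp-↭; All-resp-↭; ↭-length)
import Data.List.Relation.Binary.Permutation.Setoid.Properties as Permutationₛ
open import Data.List.Relation.Binary.Sublist.Propositional using (_⊆_; ⊆-refl)
import Data.List.Relation.Binary.Sublist.Heterogeneous as Sub
open import Data.List.Relation.Binary.Sublist.Propositional.Properties using (Any-resp-⊆)
import Data.List.Relation.Binary.Sublist.Heterogeneous.Properties as Sublist
open import Data.Product using (Σ; ∃; ∃₂; _×_; _,_; proj₁; proj₂)
open import Data.Sum using (_⊎_; inj₁; inj₂)
open import Data.Empty using (⊥-elim)
open import Function using (_∘_)
open import Function.Definitions using (Injective)
open import Relation.Nullary using (¬_; ¬?; Dec; yes; no; _×-dec_; _⊎-dec_; map′)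
open import Relation.Binary.PropositionalEquality hiding ([_])
open import Defs

++-meet : ∀ {A : Set} (U V P R : List A) → U ++ V ≡ P ++ R →
          (∃ λ M → P ≡ U ++ M × V ≡ M ++ R) ⊎ (∃ λ M → U ≡ P ++ M × R ≡ M ++ V)
++-meet []      V P       R eq = inj₁ (P , refl , eq)
++-meet (u ∷ U) V []      R eq = inj₂ (u ∷ U , refl , sym eq)
++-meet (u ∷ U) V (p ∷ P) R eq with refl , eq′ ← ∷-injective eq with ++-meet U V P R eq′
... | inj₁ (M , refl , V≡) = inj₁ (M , refl , V≡)
... | inj₂ (M , refl , R≡) = inj₂ (M , refl , R≡)

++-∷-cancel : ∀ {A : Set} {h : A} W W′ {Q Q′} → h ∉ W → h ∉ W′ →
              W ++ h ∷ Q ≡ W′ ++ h ∷ Q′ → W ≡ W′ × Q ≡ Q′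
++-∷-cancel []      []       _    _     eq = refl , proj₂ (∷-injective eq)
++-∷-cancel []      (_ ∷ W′) _    h∉W′ eq = ⊥-elim (h∉W′ (here (proj₁ (∷-injective eq))))
++-∷-cancel (_ ∷ W) []       h∉W _     eq = ⊥-elim (h∉W (here (sym (proj₁ (∷-injective eq)))))
++-∷-cancel (_ ∷ W) (_ ∷ W′) h∉W h∉W′ eq with refl , eq′ ← ∷-injective eq
  with refl , refl ← ++-∷-cancel W W′ (h∉W ∘ there) (h∉W′ ∘ there) eq′ = refl , refl

snoc-view : ∀ {A : Set} (x : A) xs → ∃₂ λ P y → x ∷ xs ≡ P ∷ʳ y
snoc-view x []        = [] , x , refl
snoc-view x (x′ ∷ xs) with P , y , eq ← snoc-view x′ xs = x ∷ P , y , cong (x ∷_) eq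

drop-length-++ : ∀ {A : Set} (U : List A) {V} → drop (length U) (U ++ V) ≡ V
drop-length-++ []      = refl
drop-length-++ (_ ∷ U) = drop-length-++ U

take-length-++ : ∀ {A : Set} (U : List A) {V} → take (length U) (U ++ V) ≡ U
take-length-++ []      = refl
take-length-++ (u ∷ U) = cong (u ∷_) (take-length-++ U)

rotation-from-front : ∀ {A : Set} (x : A) U V →
                      ∃ λ k → k < length (U ++ x ∷ V) × U ++ x ∷ V ≡ drop k (x ∷ V ++ U) ++ take k (x ∷ V ++ U)
rotation-from-front x []      V = 0 , s≤s z≤n , sym (trans (++-identityʳ _) (cong (x ∷_) (++-identityʳ V)))
rotation-from-front x (u ∷ U) V = length (x ∷ V) , k< ,
  sym (cong₂ _++_ (drop-length-++ (x ∷ V)) (take-length-++ (x ∷ V)))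
  where
  k< : length (x ∷ V) < length (u ∷ U ++ x ∷ V)
  k< = subst (length (x ∷ V) <_) (sym (length-++ (u ∷ U))) (m<n+m (length (x ∷ V)) (s≤s z≤n))

All<⇒∉ : ∀ {n xs} → All (_< n) xs → n ∉ xs
All<⇒∉ xs<n n∈ = <-irrefl refl (All.lookup xs<n n∈)

Unique-resp-↭ : ∀ {A : Set} {xs ys : List A} → xs ↭ ys → Unique xs → Unique ys
Unique-resp-↭ {A} p = Permutationₛ.Unique-resp-↭ (setoid A) (↭⇒↭ₛ′ isEquivalence p)

Unique-max∷ : ∀ {n v} → All (_< n) v → Unique v → Unique (n ∷ v)
Unique-max∷ v<n v! = All.map (λ k<n n≡k → <-irrefl (sym n≡k) k<n) v<n ∷ v!

AllPairs-weaken-∈ : ∀ {A : Set} {R S : A → A → Set} {xs} → (∀ {x y} → x ∈ xs → y ∈ xs → R x y → S x y) →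
                    AllPairs R xs → AllPairs S xs
AllPairs-weaken-∈ R⇒S []         = []
AllPairs-weaken-∈ R⇒S (Rx ∷ Rxs) =
  All.tabulate (λ y∈ → R⇒S (here refl) (there y∈) (All.lookup Rx y∈))
  ∷ AllPairs-weaken-∈ (λ x∈ y∈ → R⇒S (there x∈) (there y∈)) Rxs

module _ {A B : Set} where

  Unique-map⁺-∈ : ∀ (f : A → B) {xs} → (∀ {x y} → x ∈ xs → y ∈ xs → f x ≡ f y → x ≡ y) →
                  Unique xs → Unique (map f xs)
  Unique-map⁺-∈ f inj xs! = AllPairsₚ.map⁺ (AllPairs-weaken-∈ (λ x∈ y∈ x≢y → x≢y ∘ inj x∈ y∈) xs!)

  Unique-concatMap⁺ : ∀ (f : A → List B) {xs} → Unique xs → All (Unique ∘ f) xs →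
                      (∀ {x y c} → x ∈ xs → y ∈ xs → c ∈ f x → c ∈ f y → x ≡ y) → Unique (concatMap f xs)
  Unique-concatMap⁺ f xs! fxs! shared = Uniqueₚ.concat⁺ (Allₚ.map⁺ fxs!)
    (AllPairsₚ.map⁺ (AllPairs-weaken-∈ (λ x∈ y∈ x≢y (c∈fx , c∈fy) → x≢y (shared x∈ y∈ c∈fx c∈fy))
                                       xs!))

module _ {A B : Set} {xs : List A} (f : ∀ {x} → x ∈ xs → B) where

  All-mapWith∈⁺ : ∀ {P : B → Set} → (∀ {x} (x∈ : x ∈ xs) → P (f x∈)) → All P (mapWith∈ xs f)
  All-mapWith∈⁺ {P} Pf = All.tabulate λ b∈ → case b∈
    where
    case : ∀ {b} → b ∈ mapWith∈ xs f → P b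
    case b∈ with _ , x∈ , refl ← Anyₚ.mapWith∈⁻ xs f b∈ = Pf x∈

AllPairs-mapWith∈⁺ : ∀ {A B : Set} {R : B → B → Set} (xs : List A) (f : ∀ {x} → x ∈ xs → B) → Unique xs →
                     (∀ {x y} (x∈ : x ∈ xs) (y∈ : y ∈ xs) → x ≢ y → R (f x∈) (f y∈)) →
                     AllPairs R (mapWith∈ xs f)
AllPairs-mapWith∈⁺ []       f []         _   = []
AllPairs-mapWith∈⁺ (x ∷ xs) f (x∉ ∷ xs!) R-f =
  All-mapWith∈⁺ (λ y∈ → f (there y∈)) (λ y∈ → R-f (here refl) (there y∈) (All.lookup x∉ y∈))
  ∷ AllPairs-mapWith∈⁺ xs (λ y∈ → f (there y∈)) xs! (λ x∈ y∈ → R-f (there x∈) (there y∈))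

sum-map-concatMap : ∀ {A B : Set} (F : B → ℕ) (g : A → List B) xs →
                    sum (map F (concatMap g xs)) ≡ sum (map (sum ∘ map F ∘ g) xs)
sum-map-concatMap F g []       = refl
sum-map-concatMap F g (x ∷ xs) = begin
  sum (map F (g x ++ concatMap g xs))                ≡⟨ cong sum (map-++ F (g x) _) ⟩
  sum (map F (g x) ++ map F (concatMap g xs))        ≡⟨ sum-++ (map F (g x)) _ ⟩
  sum (map F (g x)) + sum (map F (concatMap g xs))   ≡⟨ cong (sum (map F (g x)) +_) (sum-map-concatMap F g xs) ⟩
  sum (map (sum ∘ map F ∘ g) (x ∷ xs))               ∎
  where open ≡-Reasoning

length≡sum-ones : ∀ {A : Set} (xs : List A) → length xs ≡ sum (map (λ _ → 1) xs)
length≡sum-ones []       = refl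
length≡sum-ones (_ ∷ xs) = cong suc (length≡sum-ones xs)


-- Out-of-range positions read as 0.
nth : List ℕ → ℕ → ℕ
nth []       _       = 0
nth (x ∷ xs) zero    = x
nth (x ∷ xs) (suc i) = nth xs i

nth-tabulate : ∀ {n} (g : Fin n → ℕ) i → nth (tabulate g) (toℕ i) ≡ g i
nth-tabulate g Fin.zero    = refl
nth-tabulate g (Fin.suc i) = nth-tabulate (g ∘ Fin.suc) i

nth-∈ : ∀ xs {i} → i < length xs → nth xs i ∈ xs
nth-∈ (x ∷ xs) {zero}  _            = here refl
nth-∈ (x ∷ xs) {suc i} (s≤s i<|xs|) = there (nth-∈ xs i<|xs|)

∈⇒nth : ∀ {x xs} → x ∈ xs → ∃ λ i → i < length xs × nth xs i ≡ x
∈⇒nth (here refl) = 0 , s≤s z≤n , refl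
∈⇒nth (there x∈) with i , i< , refl ← ∈⇒nth x∈ = suc i , s≤s i< , refl

nth-ext : ∀ u v → length u ≡ length v → (∀ {i} → i < length u → nth u i ≡ nth v i) → u ≡ v
nth-ext []      []      _   _     = refl
nth-ext (x ∷ u) (y ∷ v) |≡| nth≡ =
  cong₂ _∷_ (nth≡ (s≤s z≤n)) (nth-ext u v (suc-injective |≡|) (nth≡ ∘ s≤s))

nth-injective : ∀ xs {i j} → Unique xs → i < length xs → j < length xs → nth xs i ≡ nth xs j → i ≡ j
nth-injective (x ∷ xs) {zero}  {zero}  _          _          _          _  = refl
nth-injective (x ∷ xs) {zero}  {suc j} (x∉ ∷ _)  _          (s≤s j<)   eq = ⊥-elim (All.lookup x∉ (nth-∈ xs j<) eq)
nth-injective (x ∷ xs) {suc i} {zero}  (x∉ ∷ _)  (s≤s i<)   _          eq = ⊥-elim (All.lookup x∉ (nth-∈ xs i<) (sym eq))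
nth-injective (x ∷ xs) {suc i} {suc j} (_ ∷ xs!) (s≤s i<)   (s≤s j<)   eq = cong suc (nth-injective xs xs! i< j< eq)

nth-++ˡ : ∀ A {B i} → i < length A → nth (A ++ B) i ≡ nth A i
nth-++ˡ (a ∷ A) {i = zero}  _        = refl
nth-++ˡ (a ∷ A) {i = suc i} (s≤s i<) = nth-++ˡ A i<

nth-++ʳ : ∀ A {B} j → nth (A ++ B) (length A + j) ≡ nth B j
nth-++ʳ []      j = refl
nth-++ʳ (a ∷ A) j = nth-++ʳ A j

nth-drop : ∀ k w i → nth (drop k w) i ≡ nth w (k + i)
nth-drop zero    w       i = refl
nth-drop (suc k) []      i = refl
nth-drop (suc k) (x ∷ w) i = nth-drop k w i

nth-take : ∀ k w {i} → i < k → nth (take k w) i ≡ nth w i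
nth-take (suc k) []      _        = refl
nth-take (suc k) (x ∷ w) {zero}  _        = refl
nth-take (suc k) (x ∷ w) {suc i} (s≤s i<) = nth-take k w i<

nth-rotation : ∀ m w k {i} → length w ≡ suc m → k ≤ suc m → i < suc m →
               nth (drop k w ++ take k w) i ≡ nth w ((i + k) % suc m)
nth-rotation m w k {i} |w| k≤ i< with i <? suc m ∸ k
... | yes i<d = begin
  nth (drop k w ++ take k w) i  ≡⟨ nth-++ˡ (drop k w) (subst (i <_) (sym |drop|) i<d) ⟩
  nth (drop k w) i              ≡⟨ nth-drop k w i ⟩
  nth w (k + i)                 ≡⟨ cong (nth w) (trans (+-comm k i) (sym (m<n⇒m%n≡m i+k<))) ⟩
  nth w ((i + k) % suc m)       ∎
  where
  open ≡-Reasoning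
  |drop| : length (drop k w) ≡ suc m ∸ k
  |drop| = trans (length-drop k w) (cong (_∸ k) |w|)
  i+k< : i + k < suc m
  i+k< = subst (i + k <_) (m∸n+n≡m k≤) (+-monoˡ-< k i<d)
... | no i≮d = begin
  nth (drop k w ++ take k w) i                       ≡⟨ cong (nth (drop k w ++ take k w)) i≡ ⟩
  nth (drop k w ++ take k w) (length (drop k w) + j) ≡⟨ nth-++ʳ (drop k w) j ⟩
  nth (take k w) j                                   ≡⟨ nth-take k w j<k ⟩
  nth w j                                            ≡⟨ cong (nth w) (sym i+k%≡j) ⟩
  nth w ((i + k) % suc m)                            ∎
  where
  open ≡-Reasoning
  d j : ℕ
  d = suc m ∸ k
  j = i ∸ d
  d≤i : d ≤ i
  d≤i = ≮⇒≥ i≮d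
  i≡ : i ≡ length (drop k w) + j
  i≡ = trans (sym (m+[n∸m]≡n d≤i)) (cong (_+ j) (sym (trans (length-drop k w) (cong (_∸ k) |w|))))
  j<k : j < k
  j<k = +-cancelˡ-< d j k (subst₂ _<_ (sym (m+[n∸m]≡n d≤i)) (sym (m∸n+n≡m k≤)) i<)
  i+k%≡j : (i + k) % suc m ≡ j
  i+k%≡j = begin
    (i + k) % suc m        ≡⟨ cong (λ t → (t + k) % suc m) (trans (sym (m+[n∸m]≡n d≤i)) (+-comm d j)) ⟩
    (j + d + k) % suc m    ≡⟨ cong (_% suc m) (trans (+-assoc j d k) (cong (j +_) (m∸n+n≡m k≤))) ⟩
    (j + suc m) % suc m    ≡⟨ [m+n]%n≡m%n j (suc m) ⟩
    j % suc m              ≡⟨ m<n⇒m%n≡m (<-≤-trans j<k k≤) ⟩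
    j                      ∎

split-at : ∀ v a → suc a < length v → v ≡ take a v ++ nth v a ∷ nth v (suc a) ∷ drop (2 + a) v
split-at (x ∷ y ∷ v) zero    _       = refl
split-at (x ∷ v)     (suc a) (s≤s a<) = cong (x ∷_) (split-at v a a<)


-- The number of nodes at depth d below a node labelled k in the tree (k) ↝ (2)(3)⋯(k + 1).
descendants : ℕ → ℕ → ℕ
descendants zero    k = 1
descendants (suc d) k = sum (applyDownFrom (λ i → descendants d (2 + i)) k)

[k+1]*[n+1]C[k+1]≡[n+1]*nCk : ∀ n k → suc k * (suc n C suc k) ≡ suc n * (n C k)
[k+1]*[n+1]C[k+1]≡[n+1]*nCk zero    zero    = refl
[k+1]*[n+1]C[k+1]≡[n+1]*nCk zero    (suc k) rewrite k>n⇒nCk≡0 {1} {2 + k} (s≤s (s≤s z≤n)) | *-zeroʳ k = refl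
[k+1]*[n+1]C[k+1]≡[n+1]*nCk (suc n) zero    = trans (+-identityʳ _) (trans (nC1≡n (2 + n)) (sym (*-identityʳ (2 + n))))
[k+1]*[n+1]C[k+1]≡[n+1]*nCk (suc n) (suc k) = begin
  suc (suc k) * (suc (suc n) C suc (suc k))
    ≡⟨ cong (suc (suc k) *_) (pascal (suc n) (suc k)) ⟨
  suc (suc k) * (suc n C suc k + suc n C suc (suc k))
    ≡⟨ *-distribˡ-+ (suc (suc k)) (suc n C suc k) _ ⟩
  (suc n C suc k + suc k * (suc n C suc k)) + suc (suc k) * (suc n C suc (suc k))
    ≡⟨ cong₂ (λ a b → (suc n C suc k + a) + b)
             ([k+1]*[n+1]C[k+1]≡[n+1]*nCk n k) ([k+1]*[n+1]C[k+1]≡[n+1]*nCk n (suc k)) ⟩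
  (suc n C suc k + suc n * (n C k)) + suc n * (n C suc k)
    ≡⟨ +-assoc (suc n C suc k) _ _ ⟩
  suc n C suc k + (suc n * (n C k) + suc n * (n C suc k))
    ≡⟨ cong (suc n C suc k +_) (*-distribˡ-+ (suc n) (n C k) _) ⟨
  suc n C suc k + suc n * (n C k + n C suc k)
    ≡⟨ cong (λ c → suc n C suc k + suc n * c) (pascal n k) ⟩
  suc n C suc k + suc n * (suc n C suc k) ∎
  where open ≡-Reasoning

j*[k+j]Ck≡[k+1]*[k+j]C[k+1] : ∀ k j → j * ((k + j) C k) ≡ suc k * ((k + j) C suc k)
j*[k+j]Ck≡[k+1]*[k+j]C[k+1] k j = +-cancelˡ-≡ (suc k * X) _ _ (begin
  suc k * X + j * X                       ≡⟨ *-distribʳ-+ X (suc k) j ⟨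
  suc (k + j) * X                          ≡⟨ [k+1]*[n+1]C[k+1]≡[n+1]*nCk (k + j) k ⟨
  suc k * (suc (k + j) C suc k)            ≡⟨ cong (suc k *_) (pascal (k + j) k) ⟨
  suc k * (X + (k + j) C suc k)            ≡⟨ *-distribˡ-+ (suc k) X _ ⟩
  suc k * X + suc k * ((k + j) C suc k)    ∎)
  where
  open ≡-Reasoning
  X : ℕ
  X = (k + j) C k

-- Stated for an abstract array because unification would unfold _C_.
module PascalArray (binom : ℕ → ℕ → ℕ)
  (pascal : ∀ n k → binom n k + binom n (suc k) ≡ binom (suc n) (suc k))
  (binom-diagonal : ∀ k → binom k (suc k) ≡ 0) (binom-zero : ∀ n → binom n 0 ≡ 1) where

  private
    pascal-step : ∀ a b {n i j} → a + binom n (suc i) ≡ binom n (suc j) → b + binom n (suc (suc i)) ≡ binom n j →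
                  b + a + binom (suc n) (suc (suc i)) ≡ binom (suc n) (suc j)
    pascal-step a b {n} {i} {j} ih₁ ih₂ = begin
      b + a + binom (suc n) (suc (suc i))                  ≡⟨ cong (b + a +_) (pascal n (suc i)) ⟨
      b + a + (binom n (suc i) + binom n (suc (suc i)))    ≡⟨ +-assoc b a _ ⟩
      b + (a + (binom n (suc i) + binom n (suc (suc i))))  ≡⟨ cong (b +_) (+-assoc a _ _) ⟨
      b + (a + binom n (suc i) + binom n (suc (suc i)))    ≡⟨ cong (λ x → b + (x + binom n (suc (suc i)))) ih₁ ⟩
      b + (binom n (suc j) + binom n (suc (suc i)))        ≡⟨ cong (b +_) (+-comm (binom n (suc j)) _) ⟩
      b + (binom n (suc (suc i)) + binom n (suc j))        ≡⟨ +-assoc b _ _ ⟨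
      b + binom n (suc (suc i)) + binom n (suc j)          ≡⟨ cong (_+ binom n (suc j)) ih₂ ⟩
      binom n j + binom n (suc j)                          ≡⟨ pascal n j ⟩
      binom (suc n) (suc j)                                ∎
      where open ≡-Reasoning

    recast : ∀ {a n n′ i i′ j} → n ≡ n′ → i ≡ i′ →
             a + binom n i ≡ binom n j → a + binom n′ i′ ≡ binom n′ j
    recast refl refl eq = eq

  descendants-closed : ∀ d k → descendants d (suc k) + binom (d + d + k) (suc (d + k)) ≡ binom (d + d + k) d
  descendants-closed zero    k       = trans (cong suc (binom-diagonal k)) (sym (binom-zero k))
  descendants-closed (suc d) zero    =
    recast (sym (trans (+-identityʳ (suc d + suc d)) (cong suc (+-suc d d)))) (cong (suc ∘ suc) (sym (+-identityʳ d)))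
      (pascal-step 0 (descendants d 2) refl (recast (+-comm (d + d) 1) (cong suc (+-comm d 1)) (descendants-closed d 1)))
  descendants-closed (suc d) (suc k) =
    recast (sym (trans (+-suc (suc d + suc d) k) (cong suc n≡))) (cong (suc ∘ suc) (sym (+-suc d k)))
      (pascal-step (descendants (suc d) (suc k)) (descendants d (3 + k))
        (recast n≡ refl (descendants-closed (suc d) k))
        (recast (trans (+-suc (d + d) (suc k)) (cong suc (+-suc (d + d) k)))
                (cong suc (trans (+-suc d (suc k)) (cong suc (+-suc d k))))
          (descendants-closed d (2 + k))))
    where
    n≡ : suc d + suc d + k ≡ suc (suc (d + d + k))
    n≡ = cong (λ x → suc (x + k)) (+-suc d d)

open PascalArray _C_ pascal (λ k → k>n⇒nCk≡0 (n<1+n k)) (λ _ → refl)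

catalan≡descendants : ∀ m → catalan m ≡ descendants m 1
catalan≡descendants m = begin
  ((2 * m) C m) / suc m          ≡⟨ cong (λ n → (n C m) / suc m) 2m≡m+m ⟩
  ((m + m) C m) / suc m          ≡⟨ cong (_/ suc m) (trans (*-comm (descendants m 1) (suc m)) suc-m*Dm≡) ⟨
  descendants m 1 * suc m / suc m ≡⟨ m*n/n≡m (descendants m 1) (suc m) ⟩
  descendants m 1                ∎
  where
  open ≡-Reasoning
  2m≡m+m : 2 * m ≡ m + m
  2m≡m+m = cong (m +_) (+-identityʳ m)
  closed : descendants m 1 + (m + m) C suc m ≡ (m + m) C m
  closed = subst₂ (λ n i → descendants m 1 + n C suc i ≡ n C m) (+-identityʳ (m + m)) (+-identityʳ m)
                  (descendants-closed m 0)
  suc-m*Dm≡ : suc m * descendants m 1 ≡ (m + m) C m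
  suc-m*Dm≡ = +-cancelʳ-≡ (suc m * ((m + m) C suc m)) _ _ (begin
    suc m * descendants m 1 + suc m * ((m + m) C suc m)  ≡⟨ *-distribˡ-+ (suc m) (descendants m 1) ((m + m) C suc m) ⟨
    suc m * (descendants m 1 + (m + m) C suc m)         ≡⟨ cong (suc m *_) closed ⟩
    (m + m) C m + m * ((m + m) C m)                       ≡⟨ cong ((m + m) C m +_) (j*[k+j]Ck≡[k+1]*[k+j]C[k+1] m m) ⟩
    (m + m) C m + suc m * ((m + m) C suc m)               ∎)


data Inversion (lo hi : ℕ) : List ℕ → Set where
  here  : ∀ {z xs} t → t ∈ xs → lo < t → t < z → z < hi → Inversion lo hi (z ∷ xs)
  there : ∀ {y xs} → Inversion lo hi xs → Inversion lo hi (y ∷ xs)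

module _ {lo hi : ℕ} where

  Inversion-resp-⊆ : ∀ {xs ys} → xs ⊆ ys → Inversion lo hi xs → Inversion lo hi ys
  Inversion-resp-⊆ (y Sub.∷ʳ p) inv                = there (Inversion-resp-⊆ p inv)
  Inversion-resp-⊆ (refl Sub.∷ p) (here t t∈ lo<t t<z z<hi) = here t (Any-resp-⊆ p t∈) lo<t t<z z<hi
  Inversion-resp-⊆ (refl Sub.∷ p) (there inv)         = there (Inversion-resp-⊆ p inv)

  inversion-++⁺ˡ : ∀ {xs} ys → Inversion lo hi xs → Inversion lo hi (xs ++ ys)
  inversion-++⁺ˡ ys = Inversion-resp-⊆ (Sublist.++ʳ ys ⊆-refl)

  inversion-insert : ∀ U {V} h → Inversion lo hi (U ++ V) → Inversion lo hi (U ++ h ∷ V)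
  inversion-insert U h = Inversion-resp-⊆ (Sublist.++⁺ (⊆-refl {x = U}) (h Sub.∷ʳ ⊆-refl))

  inversion-witness : ∀ {xs} → Inversion lo hi xs →
                      ∃₂ λ z t → z ∈ xs × t ∈ xs × lo < t × t < z × z < hi
  inversion-witness (here t t∈ lo<t t<z z<hi) = _ , t , here refl , there t∈ , lo<t , t<z , z<hi
  inversion-witness (there inv) with z , t , z∈ , t∈ , bounds ← inversion-witness inv
    = z , t , there z∈ , there t∈ , bounds

  inversion-++ : ∀ U {V} z t → z ∈ U → t ∈ V → lo < t → t < z → z < hi → Inversion lo hi (U ++ V)
  inversion-++ (_ ∷ U) z t (here refl) t∈ lo<t t<z z<hi = here t (∈-++⁺ʳ U t∈) lo<t t<z z<hi
  inversion-++ (_ ∷ U) z t (there z∈)  t∈ lo<t t<z z<hi = there (inversion-++ U z t z∈ t∈ lo<t t<z z<hi)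

  inversion? : ∀ xs → Dec (Inversion lo hi xs)
  inversion? []       = no λ ()
  inversion? (z ∷ xs) = map′ from to ((z <? hi ×-dec any? (λ t → (lo <? t) ×-dec (t <? z)) xs) ⊎-dec inversion? xs)
    where
    Between : ℕ → Set
    Between t = lo < t × t < z
    from : (z < hi × Any Between xs) ⊎ Inversion lo hi xs → Inversion lo hi (z ∷ xs)
    from (inj₁ (z<hi , any)) with t , t∈ , (lo<t , t<z) ← find any = here t t∈ lo<t t<z z<hi
    from (inj₂ inv)          = there inv
    to : Inversion lo hi (z ∷ xs) → (z < hi × Any Between xs) ⊎ Inversion lo hi xs
    to (here t t∈ lo<t t<z z<hi) = inj₁ (z<hi , lose t∈ (lo<t , t<z))
    to (there inv)               = inj₂ inv

  inversion-mono : ∀ {lo′ hi′ xs} → lo′ ≤ lo → hi ≤ hi′ → Inversion lo hi xs → Inversion lo′ hi′ xs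
  inversion-mono lo′≤lo hi≤hi′ (here t t∈ lo<t t<z z<hi) =
    here t t∈ (≤-<-trans lo′≤lo lo<t) t<z (<-≤-trans z<hi hi≤hi′)
  inversion-mono lo′≤lo hi≤hi′ (there inv) = there (inversion-mono lo′≤lo hi≤hi′ inv)

  inversion-bound : ∀ {hi′ xs} → All (_< hi) xs → Inversion lo hi′ xs → Inversion lo hi xs
  inversion-bound (z<hi ∷ _) (here t t∈ lo<t t<z _) = here t t∈ lo<t t<z z<hi
  inversion-bound (_ ∷ xs<hi) (there inv) = there (inversion-bound xs<hi inv)

  inversion-remove : ∀ U {V} h → Inversion lo hi (U ++ h ∷ V) →
                     Inversion lo hi (U ++ V)
                     ⊎ (∃ λ t → t ∈ V × lo < t × t < h × h < hi)
                     ⊎ (∃ λ z → z ∈ U × lo < h × h < z × z < hi)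
  inversion-remove []      h (here t t∈ lo<t t<h h<hi) = inj₂ (inj₁ (t , t∈ , lo<t , t<h , h<hi))
  inversion-remove []      h (there inv)              = inj₁ inv
  inversion-remove (z ∷ U) h (here t t∈ lo<t t<z z<hi) with ∈-++⁻ U t∈
  ... | inj₁ t∈U         = inj₁ (here t (∈-++⁺ˡ t∈U) lo<t t<z z<hi)
  ... | inj₂ (here refl) = inj₂ (inj₂ (z , here refl , lo<t , t<z , z<hi))
  ... | inj₂ (there t∈V) = inj₁ (here t (∈-++⁺ʳ U t∈V) lo<t t<z z<hi)
  inversion-remove (z ∷ U) h (there inv) with inversion-remove U h inv
  ... | inj₁ inv′                  = inj₁ (there inv′)
  ... | inj₂ (inj₁ below)          = inj₂ (inj₁ below)
  ... | inj₂ (inj₂ (z′ , z′∈ , p)) = inj₂ (inj₂ (z′ , there z′∈ , p))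

  inversion-removeLarge : ∀ U {V} h → hi ≤ h → Inversion lo hi (U ++ h ∷ V) → Inversion lo hi (U ++ V)
  inversion-removeLarge U h hi≤h inv with inversion-remove U h inv
  ... | inj₁ inv′                             = inv′
  ... | inj₂ (inj₁ (_ , _ , _ , _ , h<hi))     = ⊥-elim (<-irrefl refl (<-≤-trans h<hi hi≤h))
  ... | inj₂ (inj₂ (_ , _ , _ , h<z , z<hi))   = ⊥-elim (<-asym h<z (<-≤-trans z<hi hi≤h))

  inversion-∷ : ∀ A {B} z t → t ∈ B → lo < t → t < z → z < hi → Inversion lo hi (A ++ z ∷ B)
  inversion-∷ []      z t t∈ lo<t t<z z<hi = here t t∈ lo<t t<z z<hi
  inversion-∷ (_ ∷ A) z t t∈ lo<t t<z z<hi = there (inversion-∷ A z t t∈ lo<t t<z z<hi)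

  ¬inversion-below : ∀ {xs} → All (_≤ lo) xs → ¬ Inversion lo hi xs
  ¬inversion-below xs≤lo inv with _ , t , _ , t∈ , lo<t , _ ← inversion-witness inv =
    <⇒≱ lo<t (All.lookup xs≤lo t∈)

  inversion-at : ∀ Q {i j} → i < j → j < length Q →
                 lo < nth Q j → nth Q j < nth Q i → nth Q i < hi → Inversion lo hi Q
  inversion-at (q ∷ Q) {zero}  {suc j} _         (s≤s j<) = here (nth Q j) (nth-∈ Q j<)
  inversion-at (q ∷ Q) {suc i} {suc j} (s≤s i<j) (s≤s j<) lo<t t<z z<hi = there (inversion-at Q i<j j< lo<t t<z z<hi)

  inversion-positions : ∀ {Q} → Inversion lo hi Q →
    ∃₂ λ i j → i < j × j < length Q × lo < nth Q j × nth Q j < nth Q i × nth Q i < hi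
  inversion-positions {q ∷ Q} (here t t∈ lo<t t<z z<hi) with j , j< , refl ← ∈⇒nth t∈ =
    0 , suc j , s≤s z≤n , s≤s j< , lo<t , t<z , z<hi
  inversion-positions {q ∷ Q} (there inv) with i , j , i<j , j< , bounds ← inversion-positions inv =
    suc i , suc j , s≤s i<j , s≤s j< , bounds

module _ {lo N : ℕ} where

  inversion-insertMax⁺ : ∀ W {L} → Inversion lo N (W ++ L) → Inversion lo (suc N) (W ++ N ∷ L)
  inversion-insertMax⁺ W inv = inversion-mono ≤-refl (n≤1+n N) (inversion-insert W N inv)

  inversion-insertMax⁻ : ∀ W {L g} → g ∈ W → All (_< g) L → All (_< N) (W ++ L) →
                         Inversion lo (suc N) (W ++ N ∷ L) → Inversion lo N (W ++ L)
  inversion-insertMax⁻ W g∈W L<g WL<N inv with inversion-remove W N inv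
  ... | inj₁ inv′ = inversion-bound WL<N inv′
  ... | inj₂ (inj₁ (t , t∈L , lo<t , _)) =
    inversion-++ W _ t g∈W t∈L lo<t (All.lookup L<g t∈L) (All.lookup WL<N (∈-++⁺ˡ g∈W))
  ... | inj₂ (inj₂ (z , z∈W , _ , N<z , _)) = ⊥-elim (<-asym N<z (All.lookup WL<N (∈-++⁺ˡ z∈W)))

  ¬inversion-aboveMax : ∀ A {B} → All (_≤ lo) (A ++ B) → ¬ Inversion lo (suc N) (A ++ N ∷ B)
  ¬inversion-aboveMax A AB≤lo inv with inversion-remove A N inv
  ... | inj₁ inv′ = ¬inversion-below AB≤lo inv′
  ... | inj₂ (inj₁ (t , t∈B , lo<t , _)) = <⇒≱ lo<t (All.lookup AB≤lo (∈-++⁺ʳ A t∈B))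
  ... | inj₂ (inj₂ (z , z∈A , lo<N , N<z , _)) = <⇒≱ (<-trans lo<N N<z) (All.lookup AB≤lo (∈-++⁺ˡ z∈A))


-- The rotation V ++ U of w starts with the adjacent letters x < y (the 14 of the pattern),
-- and an inversion strictly between them (the 32) follows.
data CyclicOccurrence (w : List ℕ) : Set where
  occurrence : ∀ U {x y} Q V → w ≡ U ++ V → V ++ U ≡ x ∷ y ∷ Q → x < y → Inversion x y Q → CyclicOccurrence w

cyclicOccurrence-rotate : ∀ A B → CyclicOccurrence (A ++ B) → CyclicOccurrence (B ++ A)
cyclicOccurrence-rotate A B (occurrence U Q V eq rot x<y inv) with ++-meet A B U V eq
... | inj₁ (M , refl , refl) = occurrence M Q (V ++ A) (++-assoc M V A) (trans (++-assoc V A M) rot) x<y inv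
... | inj₂ (M , refl , refl) = occurrence (B ++ U) Q M (sym (++-assoc B U M)) (trans (sym (++-assoc M B U)) rot) x<y inv

linear⇒cyclicOccurrence : ∀ P {x y} Q → x < y → Inversion x y Q → CyclicOccurrence (P ++ x ∷ y ∷ Q)
linear⇒cyclicOccurrence P Q x<y inv = occurrence P (Q ++ P) (_ ∷ _ ∷ Q) refl refl x<y (inversion-++⁺ˡ P inv)

CyclicOccurrence-length : ∀ {w} → CyclicOccurrence w → 2 ≤ length w
CyclicOccurrence-length (occurrence U Q V refl rot _ _) =
  subst (2 ≤_) (trans (cong length (sym rot)) (↭-length (++-comm V U))) (s≤s (s≤s z≤n))

-- Cyclically, N ∷ X ∷ʳ a is the word X ∷ʳ a with N inserted after its last letter a.
module _ {N : ℕ} where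

  prependMax⁻ : ∀ X a → All (_< N) (X ∷ʳ a) → CyclicOccurrence (N ∷ X ∷ʳ a) →
                CyclicOccurrence (X ∷ʳ a) ⊎ Inversion a N X
  prependMax⁻ X a X<N (occurrence [] Q V refl rot x<y inv) with refl , X≡y∷Q ← ∷-injective rot =
    ⊥-elim (<-asym x<y (All.lookup (Allₚ.++⁺ X<N []) (subst (_ ∈_) (sym X≡y∷Q) (here refl))))
  prependMax⁻ X a X<N (occurrence (u ∷ U) Q V eq rot x<y inv) with ∷-injective eq
  prependMax⁻ X a X<N (occurrence (u ∷ U) Q [] eq rot x<y inv) | refl , X≡U++V
    with refl , U≡y∷Q ← ∷-injective rot =
    ⊥-elim (<-asym x<y (All.lookup (subst (All (_< N)) X≡U++V X<N)
                                   (∈-++⁺ˡ (subst (_ ∈_) (sym U≡y∷Q) (here refl)))))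
  prependMax⁻ X a X<N (occurrence (u ∷ U) Q (v ∷ []) eq rot x<y inv) | refl , X≡U++V
    with refl , refl ← ∷-injective rot with refl , refl ← ∷ʳ-injective X U X≡U++V = inj₂ inv
  prependMax⁻ X a X<N (occurrence (u ∷ U) Q (v ∷ v′ ∷ V) eq rot x<y inv) | refl , X≡U++V
    with refl , rot′ ← ∷-injective rot with refl , refl ← ∷-injective rot′ =
    inj₁ (occurrence U (V ++ U) (v ∷ v′ ∷ V) X≡U++V refl x<y (inversion-removeLarge V N (<⇒≤ v′<N) inv))
    where
    v′<N : v′ < N
    v′<N = All.lookup (subst (All (_< N)) X≡U++V X<N) (∈-++⁺ʳ U (there (here refl)))

  prependMax⁺ : ∀ X a → All (_< N) (X ∷ʳ a) → CyclicOccurrence (X ∷ʳ a) ⊎ Inversion a N X →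
                CyclicOccurrence (N ∷ X ∷ʳ a)
  prependMax⁺ X a X<N (inj₂ inv) =
    occurrence (N ∷ X) X (a ∷ []) refl refl (All.lookup X<N (∈-++⁺ʳ X (here refl))) inv
  prependMax⁺ X a X<N (inj₁ (occurrence U Q [] eq rot x<y inv)) =
    occurrence (N ∷ []) (Q ∷ʳ N) U (cong (N ∷_) (trans eq (++-identityʳ U))) (cong (_∷ʳ N) rot) x<y
               (inversion-++⁺ˡ (N ∷ []) inv)
  prependMax⁺ X a X<N (inj₁ (occurrence U Q (v ∷ []) eq refl x<y inv)) with refl , refl ← ∷ʳ-injective X (_ ∷ Q) eq =
    prependMax⁺ X a X<N (inj₂ (there (inversion-mono ≤-refl y≤N inv)))
    where
    y≤N : _ ≤ N
    y≤N = <⇒≤ (All.lookup X<N (here refl))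
  prependMax⁺ X a X<N (inj₁ (occurrence U Q (v ∷ v′ ∷ V) eq refl x<y inv)) =
    occurrence (N ∷ U) (V ++ N ∷ U) (v ∷ v′ ∷ V) (cong (N ∷_) eq) refl x<y (inversion-insert V N inv)

cyclicOccurrence-prependMax : ∀ {N X} → All (_< N) X → CyclicOccurrence X → CyclicOccurrence (N ∷ X)
cyclicOccurrence-prependMax {X = X} X<N occ with initLast X
... | []      with () ← CyclicOccurrence-length occ
... | X′ ∷ʳ′ a = prependMax⁺ X′ a X<N (inj₁ occ)


-- The site (L , y , R) of the word L ++ y ∷ R is the gap after y; sitesAfter P W lists the sites of
-- P ++ W that lie in W, from left to right.
Site : Set
Site = List ℕ × ℕ × List ℕ

sitesAfter : List ℕ → List ℕ → List Site
sitesAfter P []      = []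
sitesAfter P (y ∷ W) = (P , y , W) ∷ sitesAfter (P ∷ʳ y) W

sites : List ℕ → List Site
sites = sitesAfter []

∈-sitesAfter⁻ : ∀ {P W L y R} → (L , y , R) ∈ sitesAfter P W → ∃ λ L′ → L ≡ P ++ L′ × W ≡ L′ ++ y ∷ R
∈-sitesAfter⁻ {P} {_ ∷ W} (here refl) = [] , sym (++-identityʳ P) , refl
∈-sitesAfter⁻ {P} {y ∷ W} (there s∈) with L′ , refl , refl ← ∈-sitesAfter⁻ s∈ =
  y ∷ L′ , ++-assoc P [ y ] L′ , refl

∈-sitesAfter⁺ : ∀ P L y R → (P ++ L , y , R) ∈ sitesAfter P (L ++ y ∷ R)
∈-sitesAfter⁺ P []      y R = here (cong (λ Q → Q , y , R) (++-identityʳ P))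
∈-sitesAfter⁺ P (l ∷ L) y R = there (subst (λ Q → (Q , y , R) ∈ sitesAfter (P ∷ʳ l) (L ++ y ∷ R))
                                           (++-assoc P [ l ] L) (∈-sitesAfter⁺ (P ∷ʳ l) L y R))

extendLeft : List ℕ → Site → Site
extendLeft P (L , y , R) = (P ++ L , y , R)

extendRight : List ℕ → Site → Site
extendRight B (L , y , R) = (L , y , R ++ B)

sitesAfter-++ : ∀ P A B → sitesAfter P (A ++ B) ≡ map (extendRight B) (sitesAfter P A) ++ sitesAfter (P ++ A) B
sitesAfter-++ P []      B = cong (λ Q → sitesAfter Q B) (sym (++-identityʳ P))
sitesAfter-++ P (y ∷ A) B = cong ((P , y , A ++ B) ∷_) (trans (sitesAfter-++ (P ∷ʳ y) A B)
  (cong (λ Q → map (extendRight B) (sitesAfter (P ∷ʳ y) A) ++ sitesAfter Q B) (++-assoc P [ y ] A)))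

sitesAfter-extendLeft : ∀ P Q W → sitesAfter (P ++ Q) W ≡ map (extendLeft P) (sitesAfter Q W)
sitesAfter-extendLeft P Q []      = refl
sitesAfter-extendLeft P Q (y ∷ W) = cong ((P ++ Q , y , W) ∷_)
  (trans (cong (λ Q′ → sitesAfter Q′ W) (++-assoc P Q [ y ])) (sitesAfter-extendLeft P (Q ∷ʳ y) W))

sitesAfter≡map-sites : ∀ P W → sitesAfter P W ≡ map (extendLeft P) (sites W)
sitesAfter≡map-sites P W = trans (cong (λ Q → sitesAfter Q W) (sym (++-identityʳ P))) (sitesAfter-extendLeft P [] W)

sitesAfter-unique : ∀ P W → Unique (sitesAfter P W)
sitesAfter-unique P []      = []
sitesAfter-unique P (y ∷ W) = All.tabulate fresh ∷ sitesAfter-unique (P ∷ʳ y) W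
  where
  fresh : ∀ {s} → s ∈ sitesAfter (P ∷ʳ y) W → (P , y , W) ≢ s
  fresh s∈ refl with L′ , P≡ , _ ← ∈-sitesAfter⁻ {P ∷ʳ y} {W} s∈
    with () ← ++-cancelˡ P [] (y ∷ L′) (trans (++-identityʳ P) (trans P≡ (++-assoc P [ y ] L′)))

-- By prependMax, inserting a new maximum N at a site of an avoiding word keeps it avoiding iff the site
-- is active.
Active : ℕ → Site → Set
Active N (L , y , R) = ¬ Inversion y N (R ++ L)

active? : ∀ N s → Dec (Active N s)
active? N (L , y , R) = ¬? (inversion? (R ++ L))

#active : ℕ → List Site → ℕ
#active N S = length (filter (active? N) S)

label : ℕ → List ℕ → ℕ
label N w = #active N (sites w)

-- Insert N after y and rotate so that N comes first.
insertAfter : ℕ → Site → List ℕ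
insertAfter N (L , y , R) = N ∷ (R ++ L) ∷ʳ y

children : ℕ → List ℕ → List (List ℕ)
children N w = map (insertAfter N) (filter (active? N) (sites w))

representatives : ℕ → List (List ℕ)
representatives zero    = [ [ 0 ] ]
representatives (suc n) = concatMap (children (suc n)) (representatives n)

∈-children⁻ : ∀ {N w c} → c ∈ children N w →
              ∃₂ λ P y → ∃ λ R → w ≡ P ++ y ∷ R × Active N (P , y , R) × c ≡ insertAfter N (P , y , R)
∈-children⁻ {N} {w} c∈
  with (P , y , R) , s∈ , refl ← ∈-map⁻ (insertAfter N) c∈
  with s∈sites , active ← ∈-filter⁻ (active? N) s∈
  with P , refl , refl ← ∈-sitesAfter⁻ {[]} {w} s∈sites
  = P , y , R , refl , active , refl

∈-children⁺ : ∀ {N w} P y R → w ≡ P ++ y ∷ R → Active N (P , y , R) → insertAfter N (P , y , R) ∈ children N w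
∈-children⁺ {N} P y R refl active = ∈-map⁺ (insertAfter N) (∈-filter⁺ (active? N) (∈-sitesAfter⁺ [] P y R) active)

split-head : ∀ {n v} P y R → n ∷ v ≡ P ++ y ∷ R → Σ (List ℕ) λ T → P ∷ʳ y ≡ n ∷ T × v ≡ T ++ R
split-head []      y R refl = [] , refl , refl
split-head (p ∷ P) y R eq with refl , refl ← ∷-injective eq = P ∷ʳ y , refl , sym (++-assoc P [ y ] R)

insertAfter-split : ∀ {n} P y R T → P ∷ʳ y ≡ n ∷ T → insertAfter (suc n) (P , y , R) ≡ suc n ∷ R ++ n ∷ T
insertAfter-split P y R T Py≡ = cong (_ ∷_) (trans (++-assoc R P [ y ]) (cong (R ++_) Py≡))

site-rotation : ∀ {w : List ℕ} P y R → w ≡ P ++ y ∷ R → w ↭ (R ++ P) ∷ʳ y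
site-rotation P y R refl =
  subst₂ _↭_ (++-assoc P [ y ] R) (sym (++-assoc R P [ y ])) (++-comm (P ∷ʳ y) R)

insertAfter-below : ∀ {n v} P y R → All (_< n) v → n ∷ v ≡ P ++ y ∷ R → All (_< suc n) ((R ++ P) ∷ʳ y)
insertAfter-below P y R v<n w≡ = All-resp-↭ (site-rotation P y R w≡) (≤-refl ∷ All.map m<n⇒m<1+n v<n)

∈-children-shape : ∀ {n v c} → c ∈ children (suc n) (n ∷ v) →
                   ∃₂ λ R T → c ≡ suc n ∷ R ++ n ∷ T × v ≡ T ++ R
∈-children-shape {n} {v} c∈
  with P , y , R , w≡ , _ , refl ← ∈-children⁻ {suc n} {n ∷ v} c∈
  with T , Py≡ , v≡ ← split-head {n} {v} P y R w≡
  = R , T , insertAfter-split P y R T Py≡ , v≡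


-- n ∷ v is the rotation starting with its maximum of an avoiding cyclic permutation of 0 … n.
data Canonical (n : ℕ) : List ℕ → Set where
  canonical : ∀ {v} → All (_< n) v → Unique v → (∀ {k} → k < n → k ∈ v) → length v ≡ n →
              ¬ CyclicOccurrence (n ∷ v) → Canonical n (n ∷ v)

canonical-avoids : ∀ {n w} → Canonical n w → ¬ CyclicOccurrence w
canonical-avoids (canonical _ _ _ _ avoids) = avoids

children-canonical : ∀ {n w c} → Canonical n w → c ∈ children (suc n) w → Canonical (suc n) c
children-canonical {n} (canonical {v} v<n v! v⊇ |v| w-avoids) c∈
  with P , y , R , w≡ , active , refl ← ∈-children⁻ {suc n} {n ∷ v} c∈
  = canonical X<N (Unique-resp-↭ rot (Unique-max∷ v<n v!)) X⊇ |X| c-avoids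
  where
  X : List ℕ
  X = (R ++ P) ∷ʳ y
  rot : n ∷ v ↭ X
  rot = site-rotation P y R w≡
  X<N : All (_< suc n) X
  X<N = insertAfter-below P y R v<n w≡
  X⊇ : ∀ {k} → k < suc n → k ∈ X
  X⊇ k<N with m<1+n⇒m<n∨m≡n k<N
  ... | inj₁ k<n  = ∈-resp-↭ rot (there (v⊇ k<n))
  ... | inj₂ refl = ∈-resp-↭ rot (here refl)
  |X| : length X ≡ suc n
  |X| = trans (sym (↭-length rot)) (cong suc |v|)
  c-avoids : ¬ CyclicOccurrence (suc n ∷ X)
  c-avoids occ with prependMax⁻ (R ++ P) y X<N occ
  ... | inj₂ inv = active inv
  ... | inj₁ occ′ = w-avoids (subst CyclicOccurrence (trans (++-assoc P [ y ] R) (sym w≡))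
                      (cyclicOccurrence-rotate R (P ∷ʳ y) (subst CyclicOccurrence (++-assoc R P [ y ]) occ′)))

representatives-canonical : ∀ n {w} → w ∈ representatives n → Canonical n w
representatives-canonical zero    (here refl) =
  canonical [] [] (λ ()) refl (λ occ → <⇒≱ (s≤s (s≤s z≤n)) (CyclicOccurrence-length occ))
representatives-canonical (suc n) c∈
  with w , w∈ , c∈children ← find (∈-concatMap⁻ (children (suc n)) c∈)
  = children-canonical (representatives-canonical n w∈) c∈children

canonical-rotateToMax : ∀ {n} W Q → All (_< suc n) (W ++ n ∷ Q) → Unique (W ++ n ∷ Q) →
                     (∀ {k} → k < suc n → k ∈ W ++ n ∷ Q) → length (W ++ n ∷ Q) ≡ suc n →
                     ¬ CyclicOccurrence (W ++ n ∷ Q) → Canonical n (n ∷ Q ++ W)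
canonical-rotateToMax {n} W Q X<N X! X⊇ |X| X-avoids
  with n∉p ∷ p! ← Unique-resp-↭ (↭-sym (++-comm (n ∷ Q) W)) X!
  = canonical p<n p! p⊇ (suc-injective (trans (↭-length rot) |X|)) (X-avoids ∘ cyclicOccurrence-rotate (n ∷ Q) W)
  where
  rot : n ∷ Q ++ W ↭ W ++ n ∷ Q
  rot = ++-comm (n ∷ Q) W
  p<n : All (_< n) (Q ++ W)
  p<n = All.tabulate λ k∈ → ≤∧≢⇒< (m<1+n⇒m≤n (All.lookup (All-resp-↭ (↭-sym rot) X<N) (there k∈)))
                                   (λ k≡n → All.lookup n∉p k∈ (sym k≡n))
  p⊇ : ∀ {k} → k < n → k ∈ Q ++ W
  p⊇ k<n with ∈-resp-↭ (↭-sym rot) (X⊇ (m<n⇒m<1+n k<n))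
  ... | here refl = ⊥-elim (<-irrefl refl k<n)
  ... | there k∈  = k∈

children-injective : ∀ {n w w′ c} → Canonical n w → Canonical n w′ →
                     c ∈ children (suc n) w → c ∈ children (suc n) w′ → w ≡ w′
children-injective {n} (canonical {v} v<n _ _ _ _) (canonical {v′} v′<n _ _ _ _) c∈ c∈′
  with R , T , refl , refl ← ∈-children-shape {n} {v} c∈
  with R′ , T′ , c≡ , refl ← ∈-children-shape {n} {v′} c∈′
  with refl , refl ← ++-∷-cancel R R′ (All<⇒∉ (Allₚ.++⁻ʳ T v<n)) (All<⇒∉ (Allₚ.++⁻ʳ T′ v′<n))
                                      (proj₂ (∷-injective c≡))
  = refl

children-unique : ∀ {n w} → Canonical n w → Unique (children (suc n) w)
children-unique {n} (canonical {v} v<n _ _ _ _) =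
  Unique-map⁺-∈ (insertAfter (suc n)) same-site (Uniqueₚ.filter⁺ (active? (suc n)) (sitesAfter-unique [] (n ∷ v)))
  where
  site-split : ∀ {P y R} → (P , y , R) ∈ filter (active? (suc n)) (sites (n ∷ v)) →
               ∃ λ T → P ∷ʳ y ≡ n ∷ T × n ∉ R
  site-split {P} {y} {R} s∈
    with P , refl , w≡ ← ∈-sitesAfter⁻ {[]} {n ∷ v} (proj₁ (∈-filter⁻ (active? (suc n)) s∈))
    with T , Py≡ , refl ← split-head {n} {v} P y R w≡
    = T , Py≡ , All<⇒∉ (Allₚ.++⁻ʳ T v<n)
  same-site : ∀ {s s′} → s ∈ filter (active? (suc n)) (sites (n ∷ v)) →
              s′ ∈ filter (active? (suc n)) (sites (n ∷ v)) →
              insertAfter (suc n) s ≡ insertAfter (suc n) s′ → s ≡ s′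
  same-site {P , y , R} {P′ , y′ , R′} s∈ s′∈ eq
    with T , Py≡ , n∉R ← site-split s∈
    with T′ , Py≡′ , n∉R′ ← site-split s′∈
    with refl , refl ← ++-∷-cancel R R′ n∉R n∉R′
           (proj₂ (∷-injective (trans (sym (insertAfter-split P y R T Py≡))
                                      (trans eq (insertAfter-split P′ y′ R′ T′ Py≡′)))))
    with refl , refl ← ∷ʳ-injective P P′ (trans Py≡ (sym Py≡′))
    = refl

representatives-unique : ∀ n → Unique (representatives n)
representatives-unique zero    = [] ∷ []
representatives-unique (suc n) = Unique-concatMap⁺ (children (suc n)) (representatives-unique n)
  (All.tabulate (children-unique ∘ representatives-canonical n))
  (λ w∈ w′∈ → children-injective (representatives-canonical n w∈) (representatives-canonical n w′∈))

representatives-complete : ∀ n {w} → Canonical n w → w ∈ representatives n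
representatives-complete zero    (canonical {[]} _ _ _ _ _) = here refl
representatives-complete (suc n) (canonical {X} X<N X! X⊇ |X| τ-avoids)
  with W , Q , refl ← ∈-∃++ (X⊇ (n<1+n n))
  with P , y , nQ≡ ← snoc-view n Q
  = ∈-concatMap⁺ (children (suc n)) (lose (representatives-complete n parent-canonical) τ∈children)
  where
  parent-canonical : Canonical n (n ∷ Q ++ W)
  parent-canonical = canonical-rotateToMax W Q X<N X! X⊇ |X| (τ-avoids ∘ cyclicOccurrence-prependMax X<N)
  X≡ : W ++ n ∷ Q ≡ (W ++ P) ∷ʳ y
  X≡ = trans (cong (W ++_) nQ≡) (sym (++-assoc W P [ y ]))
  active : Active (suc n) (P , y , W)
  active inv = τ-avoids (subst (λ X → CyclicOccurrence (suc n ∷ X)) (sym X≡)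
                          (prependMax⁺ (W ++ P) y (subst (All (_< suc n)) X≡ X<N) (inj₂ inv)))
  τ∈children : suc n ∷ W ++ n ∷ Q ∈ children (suc n) (n ∷ Q ++ W)
  τ∈children = subst (_∈ children (suc n) (n ∷ Q ++ W)) (cong (suc n ∷_) (sym X≡))
                 (∈-children⁺ P y W (trans (cong (_++ W) nQ≡) (++-assoc P [ y ] W)) active)


#active-accept : ∀ {N} s S → Active N s → #active N (s ∷ S) ≡ suc (#active N S)
#active-accept {N} s S = cong length ∘ filter-accept (active? N) {s} {S}

#active-reject : ∀ {N} s S → ¬ Active N s → #active N (s ∷ S) ≡ #active N S
#active-reject {N} s S = cong length ∘ filter-reject (active? N) {s} {S}

#active-++ : ∀ N S S′ → #active N (S ++ S′) ≡ #active N S + #active N S′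
#active-++ N S S′ = trans (cong length (filter-++ (active? N) S S′)) (length-++ (filter (active? N) S))

#active-map-cong : ∀ {N N′} (f g : Site → Site) S →
                   (∀ {s} → s ∈ S → (Active N (f s) → Active N′ (g s)) × (Active N′ (g s) → Active N (f s))) →
                   #active N (map f S) ≡ #active N′ (map g S)
#active-map-cong f g []      _ = refl
#active-map-cong {N} {N′} f g (s ∷ S) f⇔g with active? N (f s) | active? N′ (g s)
... | yes fs | yes gs = begin
  #active N (f s ∷ map f S)     ≡⟨ #active-accept (f s) (map f S) fs ⟩
  suc (#active N (map f S))     ≡⟨ cong suc (#active-map-cong f g S (f⇔g ∘ there)) ⟩
  suc (#active N′ (map g S))    ≡⟨ #active-accept (g s) (map g S) gs ⟨
  #active N′ (g s ∷ map g S)    ∎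
  where open ≡-Reasoning
... | no ¬fs | no ¬gs = begin
  #active N (f s ∷ map f S)     ≡⟨ #active-reject (f s) (map f S) ¬fs ⟩
  #active N (map f S)           ≡⟨ #active-map-cong f g S (f⇔g ∘ there) ⟩
  #active N′ (map g S)          ≡⟨ #active-reject (g s) (map g S) ¬gs ⟨
  #active N′ (g s ∷ map g S)    ∎
  where open ≡-Reasoning
... | yes fs | no ¬gs = ⊥-elim (¬gs (proj₁ (f⇔g (here refl)) fs))
... | no ¬fs | yes gs = ⊥-elim (¬fs (proj₂ (f⇔g (here refl)) gs))

#active-child-from-max : ∀ {n} R T → All (_< n) (T ++ R) → #active (2 + n) (sitesAfter (suc n ∷ R) (n ∷ T)) ≡ 1
#active-child-from-max {n} R T v<n =
  trans (#active-accept (suc n ∷ R , n , T) S (¬inversion-aboveMax T (All.map <⇒≤ v<n)))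
        (cong (suc ∘ length) (filter-none (active? (2 + n)) {S} (All.tabulate dead)))
  where
  S : List Site
  S = sitesAfter ((suc n ∷ R) ∷ʳ n) T
  dead : ∀ {s} → s ∈ S → ¬ Active (2 + n) s
  dead {L′ , b , R′} s∈ ¬inv with L″ , refl , refl ← ∈-sitesAfter⁻ {(suc n ∷ R) ∷ʳ n} {T} s∈ =
    ¬inv (inversion-∷ R′ (suc n) n (∈-++⁺ˡ (∈-++⁺ʳ R (here refl)))
            (All.lookup (Allₚ.++⁻ˡ T v<n) (∈-++⁺ʳ L″ (here refl))) (n<1+n n) (n<1+n (suc n)))

#active-child-middle : ∀ {n} R T → All (_< n) (T ++ R) →
                       #active (2 + n) (map (extendRight (n ∷ T)) (sitesAfter [ suc n ] R))
                       ≡ #active (suc n) (sitesAfter (n ∷ T) R)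
#active-child-middle {n} R T v<n = begin
  #active (suc N) (map (extendRight Z) (sitesAfter [ N ] R))
    ≡⟨ cong (#active (suc N) ∘ map (extendRight Z)) (sitesAfter≡map-sites [ N ] R) ⟩
  #active (suc N) (map (extendRight Z) (map (extendLeft [ N ]) (sites R)))
    ≡⟨ cong (#active (suc N)) (map-∘ (sites R)) ⟨
  #active (suc N) (map (extendRight Z ∘ extendLeft [ N ]) (sites R))
    ≡⟨ #active-map-cong _ (extendLeft Z) (sites R) same-activity ⟩
  #active N (map (extendLeft Z) (sites R))
    ≡⟨ cong (#active N) (sitesAfter≡map-sites Z R) ⟨
  #active N (sitesAfter Z R) ∎
  where
  open ≡-Reasoning
  N : ℕ
  N = suc n
  Z : List ℕ
  Z = n ∷ T
  same-activity : ∀ {s} → s ∈ sites R →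
                  (Active (suc N) (extendRight Z (extendLeft [ N ] s)) → Active N (extendLeft Z s)) ×
                  (Active N (extendLeft Z s) → Active (suc N) (extendRight Z (extendLeft [ N ] s)))
  same-activity {L , b , R₂} s∈ with L , refl , refl ← ∈-sitesAfter⁻ {[]} {R} s∈ =
      (λ ¬inv inv → ¬inv (inversion-insertMax⁺ (R₂ ++ Z) (subst (Inversion b N) (sym (++-assoc R₂ Z L)) inv)))
    , (λ ¬inv inv → ¬inv (subst (Inversion b N) (++-assoc R₂ Z L)
                           (inversion-insertMax⁻ (R₂ ++ Z) (∈-++⁺ʳ R₂ (here refl)) L<n WL<N inv)))
    where
    T<n : All (_< n) T
    T<n = Allₚ.++⁻ˡ T v<n
    L<n : All (_< n) L
    L<n = Allₚ.++⁻ˡ L (Allₚ.++⁻ʳ T v<n)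
    R₂<n : All (_< n) R₂
    R₂<n = All.tail (Allₚ.++⁻ʳ L (Allₚ.++⁻ʳ T v<n))
    WL<N : All (_< N) ((R₂ ++ Z) ++ L)
    WL<N = Allₚ.++⁺ (Allₚ.++⁺ (All.map m<n⇒m<1+n R₂<n) (n<1+n n ∷ All.map m<n⇒m<1+n T<n))
                    (All.map m<n⇒m<1+n L<n)

-- In the child suc n ∷ R ++ n ∷ T the sites after suc n and after n are active, those in T are not,
-- and those in R are active iff they were in the parent.
label-insertAfter : ∀ {n v} P y R → All (_< n) v → n ∷ v ≡ P ++ y ∷ R →
                    label (2 + n) (insertAfter (suc n) (P , y , R)) ≡ 2 + #active (suc n) (sitesAfter (P ∷ʳ y) R)
label-insertAfter {n} {v} P y R v<n w≡ with T , Py≡ , refl ← split-head {n} {v} P y R w≡ = begin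
  label (2 + n) (N ∷ X)
    ≡⟨ #active-accept ([] , N , X) (sitesAfter [ N ] X) (¬inversion-below (Allₚ.++⁺ (All.map <⇒≤ X<N) [])) ⟩
  suc (#active (suc N) (sitesAfter [ N ] X))
    ≡⟨ cong (λ X → suc (#active (suc N) (sitesAfter [ N ] X)))
            (proj₂ (∷-injective (insertAfter-split P y R T Py≡))) ⟩
  suc (#active (suc N) (sitesAfter [ N ] (R ++ n ∷ T)))
    ≡⟨ cong (suc ∘ #active (suc N)) (sitesAfter-++ [ N ] R (n ∷ T)) ⟩
  suc (#active (suc N) (map (extendRight (n ∷ T)) (sitesAfter [ N ] R) ++ sitesAfter (N ∷ R) (n ∷ T)))
    ≡⟨ cong suc (#active-++ (suc N) (map (extendRight (n ∷ T)) (sitesAfter [ N ] R)) _) ⟩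
  suc (#active (suc N) (map (extendRight (n ∷ T)) (sitesAfter [ N ] R)) + #active (suc N) (sitesAfter (N ∷ R) (n ∷ T)))
    ≡⟨ cong suc (cong₂ _+_ (#active-child-middle R T v<n) (#active-child-from-max R T v<n)) ⟩
  suc (#active N (sitesAfter (n ∷ T) R) + 1)
    ≡⟨ cong suc (+-comm _ 1) ⟩
  2 + #active N (sitesAfter (n ∷ T) R)
    ≡⟨ cong (λ Q → 2 + #active N (sitesAfter Q R)) Py≡ ⟨
  2 + #active N (sitesAfter (P ∷ʳ y) R) ∎
  where
  open ≡-Reasoning
  N : ℕ
  N = suc n
  X : List ℕ
  X = (R ++ P) ∷ʳ y
  X<N : All (_< N) X
  X<N = insertAfter-below P y R v<n w≡

active-labels-countdown : ∀ {N} (f : Site → ℕ) P W →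
            (∀ {L y R} → (L , y , R) ∈ sitesAfter P W → f (L , y , R) ≡ 2 + #active N (sitesAfter (L ∷ʳ y) R)) →
            map f (filter (active? N) (sitesAfter P W)) ≡ applyDownFrom (2 +_) (#active N (sitesAfter P W))
active-labels-countdown     f P []      _  = refl
active-labels-countdown {N} f P (y ∷ W) f≡ with active? N (P , y , W)
... | yes active = begin
  map f (filter (active? N) ((P , y , W) ∷ S))
    ≡⟨ cong (map f) (filter-accept (active? N) {P , y , W} {S} active) ⟩
  f (P , y , W) ∷ map f (filter (active? N) S)
    ≡⟨ cong₂ _∷_ (f≡ (here refl)) (active-labels-countdown f (P ∷ʳ y) W (f≡ ∘ there)) ⟩
  applyDownFrom (2 +_) (suc (#active N S))
    ≡⟨ cong (applyDownFrom (2 +_)) (#active-accept (P , y , W) S active) ⟨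
  applyDownFrom (2 +_) (#active N ((P , y , W) ∷ S)) ∎
  where
  open ≡-Reasoning
  S : List Site
  S = sitesAfter (P ∷ʳ y) W
... | no inactive = begin
  map f (filter (active? N) ((P , y , W) ∷ S))
    ≡⟨ cong (map f) (filter-reject (active? N) {P , y , W} {S} inactive) ⟩
  map f (filter (active? N) S)
    ≡⟨ active-labels-countdown f (P ∷ʳ y) W (f≡ ∘ there) ⟩
  applyDownFrom (2 +_) (#active N S)
    ≡⟨ cong (applyDownFrom (2 +_)) (#active-reject (P , y , W) S inactive) ⟨
  applyDownFrom (2 +_) (#active N ((P , y , W) ∷ S)) ∎
  where
  open ≡-Reasoning
  S : List Site
  S = sitesAfter (P ∷ʳ y) W

labels-children : ∀ {n v} → All (_< n) v →
                  map (label (2 + n)) (children (suc n) (n ∷ v)) ≡ applyDownFrom (2 +_) (label (suc n) (n ∷ v))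
labels-children {n} {v} v<n =
  trans (sym (map-∘ (filter (active? (suc n)) (sites (n ∷ v)))))
        (active-labels-countdown (label (2 + n) ∘ insertAfter (suc n)) [] (n ∷ v) label≡)
  where
  label≡ : ∀ {L y R} → (L , y , R) ∈ sites (n ∷ v) →
           label (2 + n) (insertAfter (suc n) (L , y , R)) ≡ 2 + #active (suc n) (sitesAfter (L ∷ʳ y) R)
  label≡ {L} {y} {R} s∈ with L , refl , w≡ ← ∈-sitesAfter⁻ {[]} {n ∷ v} s∈ = label-insertAfter L y R v<n w≡

sum-descendants-children : ∀ {n v} d → All (_< n) v →
  sum (map (descendants d ∘ label (2 + n)) (children (suc n) (n ∷ v))) ≡ descendants (suc d) (label (suc n) (n ∷ v))
sum-descendants-children {n} {v} d v<n = begin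
  sum (map (descendants d ∘ label (2 + n)) ch)
    ≡⟨ cong sum (map-∘ ch) ⟩
  sum (map (descendants d) (map (label (2 + n)) ch))
    ≡⟨ cong (sum ∘ map (descendants d)) (labels-children v<n) ⟩
  sum (map (descendants d) (applyDownFrom (2 +_) (label (suc n) (n ∷ v))))
    ≡⟨ cong sum (map-applyDownFrom (2 +_) (descendants d) (label (suc n) (n ∷ v))) ⟩
  descendants (suc d) (label (suc n) (n ∷ v))                      ∎
  where
  open ≡-Reasoning
  ch : List (List ℕ)
  ch = children (suc n) (n ∷ v)

sum-descendants-representatives : ∀ n d →
  sum (map (descendants d ∘ label (suc n)) (representatives n)) ≡ descendants (n + d) 1
sum-descendants-representatives zero    d = +-identityʳ (descendants d 1)
sum-descendants-representatives (suc n) d = begin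
  sum (map (descendants d ∘ label (2 + n)) (concatMap (children (suc n)) (representatives n)))
    ≡⟨ sum-map-concatMap (descendants d ∘ label (2 + n)) (children (suc n)) (representatives n) ⟩
  sum (map (sum ∘ map (descendants d ∘ label (2 + n)) ∘ children (suc n)) (representatives n))
    ≡⟨ cong sum (map-cong-local (All.tabulate children-sum)) ⟩
  sum (map (descendants (suc d) ∘ label (suc n)) (representatives n))
    ≡⟨ sum-descendants-representatives n (suc d) ⟩
  descendants (n + suc d) 1
    ≡⟨ cong (λ k → descendants k 1) (+-suc n d) ⟩
  descendants (suc n + d) 1 ∎
  where
  open ≡-Reasoning
  children-sum : ∀ {w} → w ∈ representatives n →
    sum (map (descendants d ∘ label (2 + n)) (children (suc n) w)) ≡ descendants (suc d) (label (suc n) w)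
  children-sum w∈ with canonical v<n _ _ _ _ ← representatives-canonical n w∈ = sum-descendants-children d v<n

length-representatives : ∀ n → length (representatives n) ≡ descendants n 1
length-representatives n = begin
  length (representatives n)                                   ≡⟨ length≡sum-ones (representatives n) ⟩
  sum (map (descendants 0 ∘ label (suc n)) (representatives n)) ≡⟨ sum-descendants-representatives n 0 ⟩
  descendants (n + 0) 1                                         ≡⟨ cong (λ k → descendants k 1) (+-identityʳ n) ⟩
  descendants n 1                                               ∎
  where open ≡-Reasoning


word : ∀ {n} → (Fin n → Fin n) → List ℕ
word f = tabulate (toℕ ∘ f)

nth-word : ∀ {n} (f : Fin n → Fin n) {i} (i< : i < n) → nth (word f) i ≡ toℕ (f (fromℕ< i<))
nth-word f i< = trans (cong (nth (word f)) (sym (Fin.toℕ-fromℕ< i<))) (nth-tabulate (toℕ ∘ f) (fromℕ< i<))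

word-rotate : ∀ {m} k (f : Fin (suc m) → Fin (suc m)) → k < suc m →
              word (rotate k f) ≡ drop k (word f) ++ take k (word f)
word-rotate {m} k f k< = nth-ext _ _ |≡| nth≡
  where
  |w| : length (word f) ≡ suc m
  |w| = length-tabulate (toℕ ∘ f)
  |≡| : length (word (rotate k f)) ≡ length (drop k (word f) ++ take k (word f))
  |≡| = trans (length-tabulate (toℕ ∘ rotate k f))
              (sym (trans (↭-length (++-comm (drop k (word f)) _)) (trans (cong length (take++drop≡id k (word f))) |w|)))
  nth≡ : ∀ {i} → i < length (word (rotate k f)) → nth (word (rotate k f)) i ≡ nth (drop k (word f) ++ take k (word f)) i
  nth≡ {i} i<′ = begin
    nth (word (rotate k f)) i                          ≡⟨ nth-word (rotate k f) i< ⟩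
    toℕ (f (fromℕ< (m%n<n (toℕ (fromℕ< i<) + k) (suc m))))
      ≡⟨ cong (toℕ ∘ f) (Fin.fromℕ<-cong _ _ (cong (λ t → (t + k) % suc m) (Fin.toℕ-fromℕ< i<)) _ _) ⟩
    toℕ (f (fromℕ< (m%n<n (i + k) (suc m))))           ≡⟨ nth-word f (m%n<n (i + k) (suc m)) ⟨
    nth (word f) ((i + k) % suc m)                     ≡⟨ nth-rotation m (word f) k |w| (<⇒≤ k<) i< ⟨
    nth (drop k (word f) ++ take k (word f)) i         ∎
    where
    open ≡-Reasoning
    i< : i < suc m
    i< = subst (i <_) (length-tabulate (toℕ ∘ rotate k f)) i<′

word-injective : ∀ {n} {f g : Fin n → Fin n} → word f ≡ word g → ∀ i → f i ≡ g i
word-injective {f = f} {g} eq i =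
  Fin.toℕ-injective (trans (sym (nth-tabulate (toℕ ∘ f) i))
                           (trans (cong (λ w → nth w (toℕ i)) eq) (nth-tabulate (toℕ ∘ g) i)))

injective⇒surjective : ∀ {m} (f : Fin (suc m) → Fin (suc m)) → Injective _≡_ _≡_ f → ∀ j → ∃ λ i → f i ≡ j
injective⇒surjective {m} f f-injective j with Fin.any? (λ i → f i Fin.≟ j)
... | yes hit = hit
... | no miss
  with i , i′ , i<i′ , eq ← Fin.pigeonhole (n<1+n m) (λ i → punchOut {i = j} {j = f i} (miss ∘ (i ,_) ∘ sym))
  = ⊥-elim (Fin.<-irrefl (f-injective (Fin.punchOut-injective (miss ∘ (i ,_) ∘ sym) (miss ∘ (i′ ,_) ∘ sym) eq))
                         i<i′)

module _ {m : ℕ} (σ : Perm m) where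

  word-bounded : All (_< suc m) (word (proj₁ σ))
  word-bounded = Allₚ.tabulate⁺ (Fin.toℕ<n ∘ proj₁ σ)

  word-unique : Unique (word (proj₁ σ))
  word-unique = Uniqueₚ.tabulate⁺ (proj₂ σ ∘ Fin.toℕ-injective)

  word-complete : ∀ {k} → k < suc m → k ∈ word (proj₁ σ)
  word-complete k< with i , σi≡ ← injective⇒surjective (proj₁ σ) (proj₂ σ) (fromℕ< k<) =
    subst (_∈ word (proj₁ σ)) (trans (cong toℕ σi≡) (Fin.toℕ-fromℕ< k<))
          (∈-tabulate⁺ {f = toℕ ∘ proj₁ σ} i)

  length-word : length (word (proj₁ σ)) ≡ suc m
  length-word = length-tabulate (toℕ ∘ proj₁ σ)

module _ {m : ℕ} {w : List ℕ} (w<m : All (_< suc m) w) (w! : Unique w) (|w| : length w ≡ suc m) where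

  private
    index< : (i : Fin (suc m)) → toℕ i < length w
    index< i = subst (toℕ i <_) (sym |w|) (Fin.toℕ<n i)

    entry< : (i : Fin (suc m)) → nth w (toℕ i) < suc m
    entry< i = All.lookup w<m (nth-∈ w (index< i))

  fromWord : Perm m
  fromWord = (λ i → fromℕ< (entry< i))
           , λ {i} {j} eq → Fin.toℕ-injective (nth-injective w w! (index< i) (index< j)
               (trans (sym (Fin.toℕ-fromℕ< (entry< i))) (trans (cong toℕ eq) (Fin.toℕ-fromℕ< (entry< j)))))

  word-fromWord : word (proj₁ fromWord) ≡ w
  word-fromWord = nth-ext _ w (trans (length-tabulate (toℕ ∘ proj₁ fromWord)) (sym |w|)) nth≡
    where
    nth≡ : ∀ {i} → i < length (word (proj₁ fromWord)) → nth (word (proj₁ fromWord)) i ≡ nth w i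
    nth≡ {i} i< with i<m ← subst (i <_) (length-tabulate (toℕ ∘ proj₁ fromWord)) i< =
      trans (nth-word (proj₁ fromWord) i<m)
            (trans (Fin.toℕ-fromℕ< (entry< (fromℕ< i<m))) (cong (nth w) (Fin.toℕ-fromℕ< i<m)))

canonicalPerm : ∀ {m w} → Canonical m w → Perm m
canonicalPerm (canonical v<m v! _ |v| _) =
  fromWord (≤-refl ∷ All.map m<n⇒m<1+n v<m) (Unique-max∷ v<m v!) (cong suc |v|)

word-canonicalPerm : ∀ {m w} (c : Canonical m w) → word (proj₁ (canonicalPerm c)) ≡ w
word-canonicalPerm (canonical v<m v! _ |v| _) =
  word-fromWord (≤-refl ∷ All.map m<n⇒m<1+n v<m) (Unique-max∷ v<m v!) (cong suc |v|)

contains⇒cyclicOccurrence : ∀ {m} (g : Fin (suc m) → Fin (suc m)) → ContainsV1432 g → CyclicOccurrence (word g)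
contains⇒cyclicOccurrence {m} g (a , b , c , d , b≡ , b<c , c<d , ad , dc , cb) =
  subst CyclicOccurrence (sym (split-at v (toℕ a) a+1<))
    (linear⇒cyclicOccurrence (take (toℕ a) v) Q (subst₂ _<_ (sym (v≡ a)) (sym v-b) (<-trans ad (<-trans dc cb)))
      (inversion-at Q (∸-monoˡ-< c<d 2+a≤c) d′< (subst₂ _<_ (sym (v≡ a)) (sym (Q≡ d 2+a≤d)) ad)
                    (subst₂ _<_ (sym (Q≡ d 2+a≤d)) (sym (Q≡ c 2+a≤c)) dc)
                    (subst₂ _<_ (sym (Q≡ c 2+a≤c)) (sym v-b) cb)))
  where
  v Q : List ℕ
  v = word g
  Q = drop (2 + toℕ a) v
  |v| : length v ≡ suc m
  |v| = length-tabulate (toℕ ∘ g)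
  v≡ : ∀ e → nth v (toℕ e) ≡ toℕ (g e)
  v≡ = nth-tabulate (toℕ ∘ g)
  v-b : nth v (suc (toℕ a)) ≡ toℕ (g b)
  v-b = trans (cong (nth v) (sym b≡)) (v≡ b)
  a+1< : suc (toℕ a) < length v
  a+1< = subst₂ _<_ b≡ (sym |v|) (Fin.toℕ<n b)
  2+a≤c : 2 + toℕ a ≤ toℕ c
  2+a≤c = subst (_< toℕ c) b≡ b<c
  2+a≤d : 2 + toℕ a ≤ toℕ d
  2+a≤d = ≤-trans 2+a≤c (<⇒≤ c<d)
  Q≡ : ∀ e → 2 + toℕ a ≤ toℕ e → nth Q (toℕ e ∸ (2 + toℕ a)) ≡ toℕ (g e)
  Q≡ e ≤e = trans (nth-drop (2 + toℕ a) v _) (trans (cong (nth v) (m+[n∸m]≡n ≤e)) (v≡ e))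
  d′< : toℕ d ∸ (2 + toℕ a) < length Q
  d′< = subst (_ <_) (sym (trans (length-drop (2 + toℕ a) v) (cong (_∸ (2 + toℕ a)) |v|)))
              (∸-monoˡ-< (Fin.toℕ<n d) 2+a≤d)

headOccurrence⇒contains : ∀ {m} (g : Fin (suc m) → Fin (suc m)) {x y Q} →
                          word g ≡ x ∷ y ∷ Q → x < y → Inversion x y Q → ContainsV1432 g
headOccurrence⇒contains {m} g {x} {y} {Q} w≡ x<y inv
  with i , j , i<j , j< , x<Qj , Qj<Qi , Qi<y ← inversion-positions inv
  = pos 0 a< , pos 1 b< , pos (2 + i) c< , pos (2 + j) d<
  , trans (toℕ-pos b<) (cong suc (sym (toℕ-pos a<)))
  , subst₂ _<_ (sym (toℕ-pos b<)) (sym (toℕ-pos c<)) (s≤s (s≤s z≤n))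
  , subst₂ _<_ (sym (toℕ-pos c<)) (sym (toℕ-pos d<)) (s≤s (s≤s i<j))
  , subst₂ _<_ (sym (value a<)) (sym (value d<)) x<Qj
  , subst₂ _<_ (sym (value d<)) (sym (value c<)) Qj<Qi
  , subst₂ _<_ (sym (value c<)) (sym (value b<)) Qi<y
  where
  in-range : ∀ {k} → k < 2 + length Q → k < suc m
  in-range {k} = subst (k <_) (trans (cong length (sym w≡)) (length-tabulate (toℕ ∘ g)))
  pos : ∀ k → k < 2 + length Q → Fin (suc m)
  pos k k< = fromℕ< (in-range k<)
  toℕ-pos : ∀ {k} (k< : k < 2 + length Q) → toℕ (pos k k<) ≡ k
  toℕ-pos k< = Fin.toℕ-fromℕ< (in-range k<)
  value : ∀ {k} (k< : k < 2 + length Q) → toℕ (g (pos k k<)) ≡ nth (x ∷ y ∷ Q) k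
  value {k} k< = trans (sym (nth-word g (in-range k<))) (cong (λ w → nth w k) w≡)
  a< : 0 < 2 + length Q
  a< = s≤s z≤n
  b< : 1 < 2 + length Q
  b< = s≤s (s≤s z≤n)
  c< : 2 + i < 2 + length Q
  c< = s≤s (s≤s (<-trans i<j j<))
  d< : 2 + j < 2 + length Q
  d< = s≤s (s≤s j<)

cycContains⇒cyclicOccurrence : ∀ {m} (σ : Perm m) → CycContains σ → CyclicOccurrence (word (proj₁ σ))
cycContains⇒cyclicOccurrence (f , _) (k , k< , contains) =
  subst CyclicOccurrence (take++drop≡id k (word f))
    (cyclicOccurrence-rotate (drop k (word f)) (take k (word f))
      (subst CyclicOccurrence (word-rotate k f k<) (contains⇒cyclicOccurrence (rotate k f) contains)))

cyclicOccurrence⇒cycContains : ∀ {m} (σ : Perm m) → CyclicOccurrence (word (proj₁ σ)) → CycContains σ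
cyclicOccurrence⇒cycContains (f , _) (occurrence U Q [] w≡ rot x<y inv) =
  0 , s≤s z≤n , headOccurrence⇒contains (rotate 0 f)
                  (trans (word-rotate 0 f (s≤s z≤n))
                         (trans (++-identityʳ (word f)) (trans w≡ (trans (++-identityʳ U) rot))))
                  x<y inv
cyclicOccurrence⇒cycContains {m} (f , _) (occurrence U {x} {y} Q (v ∷ V) w≡ rot x<y inv) =
  length U , |U|< , headOccurrence⇒contains (rotate (length U) f) wU≡ x<y inv
  where
  |U|< : length U < suc m
  |U|< = subst (length U <_) (trans (sym (length-++ U)) (trans (cong length (sym w≡)) (length-tabulate (toℕ ∘ f))))
               (m<m+n (length U) (s≤s z≤n))
  wU≡ : word (rotate (length U) f) ≡ x ∷ y ∷ Q
  wU≡ = trans (word-rotate (length U) f |U|<)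
          (trans (cong (λ w → drop (length U) w ++ take (length U) w) w≡)
                 (trans (cong₂ _++_ (drop-length-++ U) (take-length-++ U)) rot))

canonicalPerm-avoids : ∀ {m w} (c : Canonical m w) → CycAvoids (canonicalPerm c)
canonicalPerm-avoids c =
  canonical-avoids c ∘ subst CyclicOccurrence (word-canonicalPerm c) ∘ cycContains⇒cyclicOccurrence (canonicalPerm c)

canonical-rotation⇒≡ : ∀ {m w₁ w₂ k} → Canonical m w₁ → Canonical m w₂ → k < suc m →
                       w₁ ≡ drop k w₂ ++ take k w₂ → w₁ ≡ w₂
canonical-rotation⇒≡ {k = zero}  _ _ _ w₁≡ = trans w₁≡ (++-identityʳ _)
canonical-rotation⇒≡ {m} {k = suc k} (canonical _ _ _ _ _) (canonical {v₂} v₂<m _ _ |v₂| _) k< w₁≡ =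
  ⊥-elim (<-irrefl m≡ (All.lookup v₂<m (nth-∈ v₂ (subst (k <_) (sym |v₂|) (≤-pred k<)))))
  where
  m≡ : nth v₂ k ≡ m
  m≡ = sym (begin
    m                                                   ≡⟨ cong (λ w → nth w 0) w₁≡ ⟩
    nth (drop (suc k) (m ∷ v₂) ++ take (suc k) (m ∷ v₂)) 0
      ≡⟨ nth-rotation m (m ∷ v₂) (suc k) (cong suc |v₂|) (<⇒≤ k<) (s≤s z≤n) ⟩
    nth (m ∷ v₂) (suc k % suc m)                        ≡⟨ cong (nth (m ∷ v₂)) (m<n⇒m%n≡m k<) ⟩
    nth v₂ k                                            ∎)
    where open ≡-Reasoning

canonicalPerm-distinct : ∀ {m w₁ w₂} (c₁ : Canonical m w₁) (c₂ : Canonical m w₂) → w₁ ≢ w₂ →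
                         ¬ SameCyclic (canonicalPerm c₁) (canonicalPerm c₂)
canonicalPerm-distinct c₁ c₂ w₁≢w₂ (k , k< , τ₁≡) = w₁≢w₂ (canonical-rotation⇒≡ c₁ c₂ k< (begin
  _                                                            ≡⟨ word-canonicalPerm c₁ ⟨
  word (proj₁ (canonicalPerm c₁))                              ≡⟨ tabulate-cong (cong toℕ ∘ τ₁≡) ⟩
  word (rotate k (proj₁ (canonicalPerm c₂)))                   ≡⟨ word-rotate k (proj₁ (canonicalPerm c₂)) k< ⟩
  drop k (word (proj₁ (canonicalPerm c₂))) ++ take k (word (proj₁ (canonicalPerm c₂)))
    ≡⟨ cong (λ w → drop k w ++ take k w) (word-canonicalPerm c₂) ⟩
  _                                                            ∎))
  where open ≡-Reasoning

sameCyclic-of-words : ∀ {m} (σ τ : Perm m) U x V → word (proj₁ σ) ≡ U ++ x ∷ V → word (proj₁ τ) ≡ x ∷ V ++ U →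
                      SameCyclic σ τ
sameCyclic-of-words {m} σ τ U x V σ≡ τ≡ with k , k< , rot≡ ← rotation-from-front x U V =
  k , k<m , word-injective (begin
    word (proj₁ σ)                                            ≡⟨ trans σ≡ rot≡ ⟩
    drop k (x ∷ V ++ U) ++ take k (x ∷ V ++ U)                ≡⟨ cong (λ w → drop k w ++ take k w) τ≡ ⟨
    drop k (word (proj₁ τ)) ++ take k (word (proj₁ τ))        ≡⟨ word-rotate k (proj₁ τ) k<m ⟨
    word (rotate k (proj₁ τ))                                 ∎)
  where
  open ≡-Reasoning
  k<m : k < suc m
  k<m = subst (k <_) (trans (cong length (sym σ≡)) (length-word σ)) k<


representativePerm : ∀ m {w} → w ∈ representatives m → Perm m
representativePerm m = canonicalPerm ∘ representatives-canonical m

representativePerms : ∀ m → List (Perm m)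
representativePerms m = mapWith∈ (representatives m) (representativePerm m)

representativePerms-avoid : ∀ m → All CycAvoids (representativePerms m)
representativePerms-avoid m = All-mapWith∈⁺ (representativePerm m) (canonicalPerm-avoids ∘ representatives-canonical m)

representativePerms-distinct : ∀ m → AllPairs (λ τ σ → ¬ SameCyclic τ σ) (representativePerms m)
representativePerms-distinct m = AllPairs-mapWith∈⁺ (representatives m) (representativePerm m) (representatives-unique m)
  (λ w∈ w′∈ → canonicalPerm-distinct (representatives-canonical m w∈) (representatives-canonical m w′∈))

representativePerms-complete : ∀ m (σ : Perm m) → CycAvoids σ → Any (SameCyclic σ) (representativePerms m)
representativePerms-complete m σ σ-avoids with U , V , w≡ ← ∈-∃++ (word-complete σ (n<1+n m)) =
  Anyₚ.mapWith∈⁺ (representativePerm m)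
    (_ , rep∈ , sameCyclic-of-words σ (representativePerm m rep∈) U m V w≡
                  (word-canonicalPerm (representatives-canonical m rep∈)))
  where
  rep∈ : m ∷ V ++ U ∈ representatives m
  rep∈ = representatives-complete m (canonical-rotateToMax U V
           (subst (All (_< suc m)) w≡ (word-bounded σ)) (subst Unique w≡ (word-unique σ))
           (λ k< → subst (_ ∈_) w≡ (word-complete σ k<)) (trans (cong length (sym w≡)) (length-word σ))
           (σ-avoids ∘ cyclicOccurrence⇒cycContains σ ∘ subst CyclicOccurrence (sym w≡)))

theorem5p10 : ∀ (m : ℕ) → AvCount m (catalan m)
theorem5p10 m = representativePerms m , representativePerms-avoid m , representativePerms-distinct m , representativePerms-complete m ,
  (begin
    length (representativePerms m)    ≡⟨ Membershipₛ.length-mapWith∈ (setoid (List ℕ)) (representatives m) ⟩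
    length (representatives m)   ≡⟨ length-representatives m ⟩
    descendants m 1              ≡⟨ catalan≡descendants m ⟨
    catalan m                    ∎)
  where open ≡-Reasoning
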